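{- For every positive integer $n$ divisible by $6$, there exists a complete geometric graph on $n$ vertices whose edge set can be partitioned into $2n/3$ plane star-forests.
   Context: A complete geometric graph on a finite point set $P\subset\mathbb{R}^2$ in general position (no three collinear) is the complete graph on $P$ with edges drawn as straight line segments. A subgraph is plane if no two of its edges cross. A star is a connected graph with one vertex (the center) adjacent to all other vertices and no other edges; a star-forest is a forest each of whose components is a star. -}

module Defs where

open import Data.Nat using (ℕ)
open import Data.Integer using (ℤ; _-_; _*_; _<_; 0ℤ)
open import Data.Fin using (Fin)
open import Data.Product using (_×_; _,_; Σ)
open import Data.Sum using (_⊎_)
open import Relation.Binary.PropositionalEquality using (_≡_; _≢_)
open import Relation.Nullary using (¬_)
open import Function using (Injective)

Point : Set
Point = ℤ × ℤ

x : Point → ℤ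
x (a , _) = a

y : Point → ℤ
y (_ , b) = b

-- Orientation determinant of the triple (p , q , r):
-- positive = counterclockwise, negative = clockwise, zero = collinear.
orient : Point → Point → Point → ℤ
orient p q r = ((x q - x p) * (y r - y p)) - ((y q - y p) * (x r - x p))

GeneralPosition : {n : ℕ} → (Fin n → Point) → Set
GeneralPosition {n} P =
  Injective _≡_ _≡_ P ×
  (∀ (i j k : Fin n) → i ≢ j → j ≢ k → i ≢ k → ¬ (orient (P i) (P j) (P k) ≡ 0ℤ))

-- For points in general position this is exactly the condition that the two
-- segments (edges of the geometric graph) intersect other than at a shared endpoint.
Crosses : {n : ℕ} → (Fin n → Point) → Fin n → Fin n → Fin n → Fin n → Set
Crosses P a b c d =
  ((orient (P a) (P b) (P c) * orient (P a) (P b) (P d)) < 0ℤ) ×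
  ((orient (P c) (P d) (P a) * orient (P c) (P d) (P b)) < 0ℤ)

Graph : ℕ → Set₁
Graph n = Fin n → Fin n → Set

Plane : {n : ℕ} → (Fin n → Point) → Graph n → Set
Plane P E = ∀ a b c d → E a b → E c d → ¬ Crosses P a b c d

-- Star-forest: a vertex-disjoint union of stars covering the vertex set.
-- f sends every vertex to the center of the star (component) containing it;
-- centers are fixed by f, and the edges are exactly center–leaf pairs.
-- (Isolated vertices are one-vertex stars.)
StarForest : {n : ℕ} → Graph n → Set
StarForest {n} E =
  Σ (Fin n → Fin n) λ f →
    (∀ v → f (f v) ≡ f v) ×
    (∀ u v → (E u v → (u ≢ v × ((f u ≡ u × f v ≡ u) ⊎ (f v ≡ v × f u ≡ v)))) ×
             ((u ≢ v × ((f u ≡ u × f v ≡ u) ⊎ (f v ≡ v × f u ≡ v))) → E u v))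

ColourClass : {n m : ℕ} → (Fin n → Fin n → Fin m) → Fin m → Graph n
ColourClass c k i j = i ≢ j × c i j ≡ k

module Submission where

-- With t_i = 3^i, take A_i = (t_i, t_i²) on the parabola y = x² and B_i = (−t_i, −2t_i²) on y = −2x², for
-- i < m = n/2. Colour 0 is the perfect matching {A_i B_i}; colour p + 1 is the pair of stars centred at A_p
-- and at B_p, where A_p is joined to the A_j with j > p and to the B_k with k < p, and B_p symmetrically.
-- These m + 1 ≤ 2n/3 star-forests partition the edges. Each orientation determinant of three of the points
-- is a product of differences of the t_i and at most one quadratic factor, and because t grows by a factor
-- of at least 3 the sign of that factor is decided by the order of the indices alone. Hence no three points
-- are collinear, and of two disjoint edges of one colour, one has both endpoints of the other on one side
-- of its line.

open import Defs
open import Data.Bool using (Bool; true; false; not; _xor_; if_then_else_)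
open import Data.Bool.Properties using (xor-comm; xor-same; xor-inverseˡ)
open import Data.Empty using (⊥-elim)
open import Function using (_∘_; id; Injective; _⇔_; Equivalence; mk⇔)
open import Data.Fin using (Fin; toℕ; fromℕ<; inject≤; splitAt; join)
open import Data.Fin.Properties using (toℕ-injective; toℕ<n; toℕ≤pred[n]; toℕ-fromℕ<; toℕ-inject≤; inject≤-injective; splitAt-join; join-splitAt)
open import Data.List using (_∷_; [])
open import Data.Integer as ℤ using (ℤ; +_; 0ℤ; +<+; -<+)
import Data.Integer.Properties as ℤP
import Data.Integer.Tactic.RingSolver as ℤSolver
open import Data.Nat using (ℕ; zero; suc; _*_; _+_; _^_; _/_; _<_; _≤_; _<?_; z≤n; s≤s)
open import Data.Nat.DivMod using (m*n/n≡m)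
open import Data.Nat.Divisibility using (_∣_; divides)
open import Data.Nat.Properties
open import Data.Nat.Tactic.RingSolver using (solve)
open import Data.Product as Product using (_×_; _,_; proj₁; proj₂; Σ)
open import Data.Sum as Sum using (_⊎_; inj₁; inj₂)
open import Relation.Binary.Definitions using (tri<; tri≈; tri>)
open import Relation.Binary.PropositionalEquality
open import Relation.Nullary using (¬_; yes; no)

Signed : ℤ → Set
Signed z = 0ℤ ℤ.< z ⊎ z ℤ.< 0ℤ

signed⇒≢0 : ∀ {z} → Signed z → z ≢ 0ℤ
signed⇒≢0 (inj₁ (+<+ (s≤s _))) ()
signed⇒≢0 (inj₂ -<+) ()

pos*pos : ∀ {i j} → 0ℤ ℤ.< i → 0ℤ ℤ.< j → 0ℤ ℤ.< i ℤ.* j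
pos*pos (+<+ (s≤s _)) (+<+ (s≤s _)) = +<+ (s≤s z≤n)

pos*neg : ∀ {i j} → 0ℤ ℤ.< i → j ℤ.< 0ℤ → i ℤ.* j ℤ.< 0ℤ
pos*neg (+<+ (s≤s _)) -<+ = -<+

neg*pos : ∀ {i j} → i ℤ.< 0ℤ → 0ℤ ℤ.< j → i ℤ.* j ℤ.< 0ℤ
neg*pos -<+ (+<+ (s≤s _)) = -<+

neg*neg : ∀ {i j} → i ℤ.< 0ℤ → j ℤ.< 0ℤ → 0ℤ ℤ.< i ℤ.* j
neg*neg -<+ -<+ = +<+ (s≤s z≤n)

signed-* : ∀ {i j} → Signed i → Signed j → Signed (i ℤ.* j)
signed-* (inj₁ i>0) (inj₁ j>0) = inj₁ (pos*pos i>0 j>0)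
signed-* (inj₁ i>0) (inj₂ j<0) = inj₂ (pos*neg i>0 j<0)
signed-* (inj₂ i<0) (inj₁ j>0) = inj₂ (neg*pos i<0 j>0)
signed-* (inj₂ i<0) (inj₂ j<0) = inj₁ (neg*neg i<0 j<0)

diff-pos : ∀ {m n} → m < n → 0ℤ ℤ.< + n ℤ.- + m
diff-pos {m} {n} m<n rewrite ℤP.m-n≡m⊖n n m | ℤP.⊖-≥ (<⇒≤ m<n) = +<+ (m<n⇒0<n∸m m<n)

+≢-+ : ∀ {m n} → 1 ≤ n → + m ≢ ℤ.- + n
+≢-+ {n = suc n} _ ()

diff-neg : ∀ {m n} → m < n → + m ℤ.- + n ℤ.< 0ℤ
diff-neg {m} {n} m<n rewrite ℤP.m-n≡m⊖n m n | ℤP.⊖-< m<n = ℤP.neg-mono-< (+<+ (m<n⇒0<n∸m m<n))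

orient-rotate : ∀ p q r → orient p q r ≡ orient q r p
orient-rotate (a , b) (c , d) (e , f) = identity a b c d e f
  where
  identity : ∀ a b c d e f → (c ℤ.- a) ℤ.* (f ℤ.- b) ℤ.- (d ℤ.- b) ℤ.* (e ℤ.- a)
                           ≡ (e ℤ.- c) ℤ.* (b ℤ.- d) ℤ.- (f ℤ.- d) ℤ.* (a ℤ.- c)
  identity = ℤSolver.solve-∀

orient-swap : ∀ p q r → orient p q r ≡ ℤ.- orient q p r
orient-swap (a , b) (c , d) (e , f) = identity a b c d e f
  where
  identity : ∀ a b c d e f → (c ℤ.- a) ℤ.* (f ℤ.- b) ℤ.- (d ℤ.- b) ℤ.* (e ℤ.- a)
                           ≡ ℤ.- ((a ℤ.- c) ℤ.* (f ℤ.- d) ℤ.- (b ℤ.- d) ℤ.* (e ℤ.- c))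
  identity = ℤSolver.solve-∀

orient-repeat : ∀ p q → orient p q p ≡ 0ℤ
orient-repeat (a , b) (c , d) = identity a b c d
  where
  identity : ∀ a b c d → (c ℤ.- a) ℤ.* (b ℤ.- b) ℤ.- (d ℤ.- b) ℤ.* (a ℤ.- a) ≡ 0ℤ
  identity = ℤSolver.solve-∀

pos-rotate : ∀ p q r → 0ℤ ℤ.< orient p q r → 0ℤ ℤ.< orient q r p
pos-rotate p q r = subst (0ℤ ℤ.<_) (orient-rotate p q r)

neg-rotate : ∀ p q r → orient p q r ℤ.< 0ℤ → orient q r p ℤ.< 0ℤ
neg-rotate p q r = subst (ℤ._< 0ℤ) (orient-rotate p q r)

-- Crosses with the four points named; a record, so that they can be inferred.
record Cross (p q r s : Point) : Set where
  constructor cross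
  field
    separates-rs : orient p q r ℤ.* orient p q s ℤ.< 0ℤ
    separates-pq : orient r s p ℤ.* orient r s q ℤ.< 0ℤ

cross-sym : ∀ {p q r s} → Cross p q r s → Cross r s p q
cross-sym (cross rs pq) = cross pq rs

cross-flipˡ : ∀ {p q r s} → Cross p q r s → Cross q p r s
cross-flipˡ {p} {q} {r} {s} (cross rs pq) =
  cross (subst (ℤ._< 0ℤ) flip rs) (subst (ℤ._< 0ℤ) (ℤP.*-comm (orient r s p) _) pq)
  where
  flip : orient p q r ℤ.* orient p q s ≡ orient q p r ℤ.* orient q p s
  flip = begin
    orient p q r ℤ.* orient p q s                 ≡⟨ cong₂ ℤ._*_ (orient-swap p q r) (orient-swap p q s) ⟩
    ℤ.- orient q p r ℤ.* ℤ.- orient q p s         ≡⟨ neg*neg≡* (orient q p r) (orient q p s) ⟩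
    orient q p r ℤ.* orient q p s                 ∎
    where
    open ≡-Reasoning
    neg*neg≡* : ∀ x y → ℤ.- x ℤ.* ℤ.- y ≡ x ℤ.* y
    neg*neg≡* = ℤSolver.solve-∀

cross-flipʳ : ∀ {p q r s} → Cross p q r s → Cross p q s r
cross-flipʳ = cross-sym ∘ cross-flipˡ ∘ cross-sym

¬cross-shared : ∀ {p q s} → ¬ Cross p q p s
¬cross-shared {p} {q} {s} (cross rs _) = ℤP.<-irrefl refl (subst (λ z → z ℤ.* orient p q s ℤ.< 0ℤ) (orient-repeat p q) rs)

data SameSide (p q r s : Point) : Set where
  left  : 0ℤ ℤ.< orient p q r → 0ℤ ℤ.< orient p q s → SameSide p q r s
  right : orient p q r ℤ.< 0ℤ → orient p q s ℤ.< 0ℤ → SameSide p q r s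

sameSide⇒¬cross : ∀ {p q r s} → SameSide p q r s → ¬ Cross p q r s
sameSide⇒¬cross (left  r s) c = ℤP.<-asym (pos*pos r s) (Cross.separates-rs c)
sameSide⇒¬cross (right r s) c = ℤP.<-asym (neg*neg r s) (Cross.separates-rs c)

sameSide⇒¬cross′ : ∀ {p q r s} → SameSide r s p q → ¬ Cross p q r s
sameSide⇒¬cross′ same = sameSide⇒¬cross same ∘ cross-sym

α : ℤ → Point
α t = (t , t ℤ.* t)

β : ℤ → Point
β t = (ℤ.- t , ℤ.- (t ℤ.* t ℤ.+ t ℤ.* t))

G : ℤ → ℤ → ℤ → ℤ
G a b c = (b ℤ.* a ℤ.+ c ℤ.* (b ℤ.+ a)) ℤ.- (c ℤ.* c ℤ.+ c ℤ.* c)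

H : ℤ → ℤ → ℤ → ℤ
H a b c = ((b ℤ.* c ℤ.+ b ℤ.* c) ℤ.+ (a ℤ.* (b ℤ.+ c) ℤ.+ a ℤ.* (b ℤ.+ c))) ℤ.- a ℤ.* a

orient-ααα : ∀ a b c → orient (α a) (α b) (α c) ≡ (b ℤ.- a) ℤ.* ((c ℤ.- a) ℤ.* (c ℤ.- b))
orient-ααα = identity
  where
  identity : ∀ a b c → (b ℤ.- a) ℤ.* (c ℤ.* c ℤ.- a ℤ.* a) ℤ.- (b ℤ.* b ℤ.- a ℤ.* a) ℤ.* (c ℤ.- a)
                     ≡ (b ℤ.- a) ℤ.* ((c ℤ.- a) ℤ.* (c ℤ.- b))
  identity = ℤSolver.solve-∀

orient-ααβ : ∀ a b c → orient (α a) (α b) (β c) ≡ (b ℤ.- a) ℤ.* G a b c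
orient-ααβ = identity
  where
  identity : ∀ a b c → (b ℤ.- a) ℤ.* (ℤ.- (c ℤ.* c ℤ.+ c ℤ.* c) ℤ.- a ℤ.* a) ℤ.- (b ℤ.* b ℤ.- a ℤ.* a) ℤ.* (ℤ.- c ℤ.- a)
                     ≡ (b ℤ.- a) ℤ.* ((b ℤ.* a ℤ.+ c ℤ.* (b ℤ.+ a)) ℤ.- (c ℤ.* c ℤ.+ c ℤ.* c))
  identity = ℤSolver.solve-∀

orient-αββ : ∀ a b c → orient (α a) (β b) (β c) ≡ (c ℤ.- b) ℤ.* H a b c
orient-αββ = identity
  where
  identity : ∀ a b c → (ℤ.- b ℤ.- a) ℤ.* (ℤ.- (c ℤ.* c ℤ.+ c ℤ.* c) ℤ.- a ℤ.* a)
                         ℤ.- (ℤ.- (b ℤ.* b ℤ.+ b ℤ.* b) ℤ.- a ℤ.* a) ℤ.* (ℤ.- c ℤ.- a)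
                     ≡ (c ℤ.- b) ℤ.* (((b ℤ.* c ℤ.+ b ℤ.* c) ℤ.+ (a ℤ.* (b ℤ.+ c) ℤ.+ a ℤ.* (b ℤ.+ c))) ℤ.- a ℤ.* a)
  identity = ℤSolver.solve-∀

orient-βββ : ∀ a b c → orient (β a) (β b) (β c) ≡ (a ℤ.- b) ℤ.* ((a ℤ.- c) ℤ.* (c ℤ.- b)) ℤ.* + 2
orient-βββ = identity
  where
  identity : ∀ a b c → (ℤ.- b ℤ.- ℤ.- a) ℤ.* (ℤ.- (c ℤ.* c ℤ.+ c ℤ.* c) ℤ.- ℤ.- (a ℤ.* a ℤ.+ a ℤ.* a))
                         ℤ.- (ℤ.- (b ℤ.* b ℤ.+ b ℤ.* b) ℤ.- ℤ.- (a ℤ.* a ℤ.+ a ℤ.* a)) ℤ.* (ℤ.- c ℤ.- ℤ.- a)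
                     ≡ (a ℤ.- b) ℤ.* ((a ℤ.- c) ℤ.* (c ℤ.- b)) ℤ.* + 2
  identity = ℤSolver.solve-∀

G-comm : ∀ a b c → G a b c ≡ G b a c
G-comm = identity
  where
  identity : ∀ a b c → (b ℤ.* a ℤ.+ c ℤ.* (b ℤ.+ a)) ℤ.- (c ℤ.* c ℤ.+ c ℤ.* c)
                     ≡ (a ℤ.* b ℤ.+ c ℤ.* (a ℤ.+ b)) ℤ.- (c ℤ.* c ℤ.+ c ℤ.* c)
  identity = ℤSolver.solve-∀

H-comm : ∀ a b c → H a b c ≡ H a c b
H-comm = identity
  where
  identity : ∀ a b c → ((b ℤ.* c ℤ.+ b ℤ.* c) ℤ.+ (a ℤ.* (b ℤ.+ c) ℤ.+ a ℤ.* (b ℤ.+ c))) ℤ.- a ℤ.* a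
                     ≡ ((c ℤ.* b ℤ.+ c ℤ.* b) ℤ.+ (a ℤ.* (c ℤ.+ b) ℤ.+ a ℤ.* (c ℤ.+ b))) ℤ.- a ℤ.* a
  identity = ℤSolver.solve-∀

G-ℕ : ∀ a b c → G (+ a) (+ b) (+ c) ≡ + (b * a + c * (b + a)) ℤ.- + (c * c + c * c)
G-ℕ a b c = sym (cong₂ ℤ._-_ positive negative)
  where
  positive : + (b * a + c * (b + a)) ≡ + b ℤ.* + a ℤ.+ + c ℤ.* (+ b ℤ.+ + a)
  positive = trans (ℤP.pos-+ (b * a) _)
               (cong₂ ℤ._+_ (ℤP.pos-* b a) (trans (ℤP.pos-* c (b + a)) (cong (+ c ℤ.*_) (ℤP.pos-+ b a))))
  negative : + (c * c + c * c) ≡ + c ℤ.* + c ℤ.+ + c ℤ.* + c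
  negative = trans (ℤP.pos-+ (c * c) _) (cong₂ ℤ._+_ (ℤP.pos-* c c) (ℤP.pos-* c c))

H-ℕ : ∀ a b c → H (+ a) (+ b) (+ c) ≡ + ((b * c + b * c) + (a * (b + c) + a * (b + c))) ℤ.- + (a * a)
H-ℕ a b c = sym (cong₂ ℤ._-_ positive (ℤP.pos-* a a))
  where
  bc : + (b * c) ≡ + b ℤ.* + c
  bc = ℤP.pos-* b c
  a[b+c] : + (a * (b + c)) ≡ + a ℤ.* (+ b ℤ.+ + c)
  a[b+c] = trans (ℤP.pos-* a (b + c)) (cong (+ a ℤ.*_) (ℤP.pos-+ b c))
  positive : + ((b * c + b * c) + (a * (b + c) + a * (b + c)))
           ≡ (+ b ℤ.* + c ℤ.+ + b ℤ.* + c) ℤ.+ (+ a ℤ.* (+ b ℤ.+ + c) ℤ.+ + a ℤ.* (+ b ℤ.+ + c))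
  positive = trans (ℤP.pos-+ (b * c + b * c) _)
               (cong₂ ℤ._+_ (trans (ℤP.pos-+ (b * c) _) (cong₂ ℤ._+_ bc bc))
                            (trans (ℤP.pos-+ (a * (b + c)) _) (cong₂ ℤ._+_ a[b+c] a[b+c])))

1≤sq : ∀ {a} → 1 ≤ a → 1 ≤ a * a
1≤sq 1≤a = *-mono-≤ 1≤a 1≤a

G-pos-ℕ : ∀ a b c → 3 * c ≤ b → 1 ≤ c → 0ℤ ℤ.< G (+ a) (+ b) (+ c)
G-pos-ℕ a b c 3c≤b 1≤c = subst (0ℤ ℤ.<_) (sym (G-ℕ a b c)) (diff-pos gap)
  where
  open ≤-Reasoning
  gap : c * c + c * c < b * a + c * (b + a)
  gap = begin-strict
    c * c + c * c             <⟨ m<m+n _ (1≤sq 1≤c) ⟩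
    c * c + c * c + c * c     ≡⟨ solve (c ∷ []) ⟩
    c * (3 * c)               ≤⟨ *-monoʳ-≤ c 3c≤b ⟩
    c * b                     ≤⟨ *-monoʳ-≤ c (m≤m+n b a) ⟩
    c * (b + a)               ≤⟨ m≤n+m _ (b * a) ⟩
    b * a + c * (b + a)       ∎

G-neg-ℕ : ∀ a b c → 3 * a ≤ b → b ≤ c → 1 ≤ a → G (+ a) (+ b) (+ c) ℤ.< 0ℤ
G-neg-ℕ a b c 3a≤b b≤c 1≤a = subst (ℤ._< 0ℤ) (sym (G-ℕ a b c)) (diff-neg gap)
  where
  open ≤-Reasoning
  1≤c : 1 ≤ c
  1≤c = ≤-trans 1≤a (≤-trans (m≤n*m a 3) (≤-trans 3a≤b b≤c))
  gap : b * a + c * (b + a) < c * c + c * c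
  gap = *-cancelˡ-< 3 _ _ (begin-strict
    3 * (b * a + c * (b + a))                ≡⟨ solve (a ∷ b ∷ c ∷ []) ⟩
    b * (3 * a) + 3 * (c * b) + c * (3 * a)
      ≤⟨ +-mono-≤ (+-mono-≤ (*-monoʳ-≤ b 3a≤b) (*-monoʳ-≤ 3 (*-monoʳ-≤ c b≤c))) (*-monoʳ-≤ c 3a≤b) ⟩
    b * b + 3 * (c * c) + c * b              ≤⟨ +-mono-≤ (+-monoˡ-≤ _ (*-mono-≤ b≤c b≤c)) (*-monoʳ-≤ c b≤c) ⟩
    c * c + 3 * (c * c) + c * c              <⟨ m<m+n _ (1≤sq 1≤c) ⟩
    c * c + 3 * (c * c) + c * c + c * c      ≡⟨ solve (c ∷ []) ⟩
    3 * (c * c + c * c)                      ∎)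

H-pos-ℕ : ∀ a b c → a ≤ b → 1 ≤ a → 0ℤ ℤ.< H (+ a) (+ b) (+ c)
H-pos-ℕ a b c a≤b 1≤a = subst (0ℤ ℤ.<_) (sym (H-ℕ a b c)) (diff-pos gap)
  where
  open ≤-Reasoning
  gap : a * a < (b * c + b * c) + (a * (b + c) + a * (b + c))
  gap = begin-strict
    a * a                                 <⟨ m<m+n _ (1≤sq 1≤a) ⟩
    a * a + a * a                         ≤⟨ +-mono-≤ (*-monoʳ-≤ a a≤b) (*-monoʳ-≤ a a≤b) ⟩
    a * b + a * b                         ≤⟨ +-mono-≤ (*-monoʳ-≤ a (m≤m+n b c)) (*-monoʳ-≤ a (m≤m+n b c)) ⟩
    a * (b + c) + a * (b + c)             ≤⟨ m≤n+m _ (b * c + b * c) ⟩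
    (b * c + b * c) + (a * (b + c) + a * (b + c)) ∎

H-neg-ℕ : ∀ a b c → 3 * b ≤ c → 3 * c ≤ a → 1 ≤ b → H (+ a) (+ b) (+ c) ℤ.< 0ℤ
H-neg-ℕ a b c 3b≤c 3c≤a 1≤b = subst (ℤ._< 0ℤ) (sym (H-ℕ a b c)) (diff-neg gap)
  where
  open ≤-Reasoning
  9b≤a : 9 * b ≤ a
  9b≤a = begin
    9 * b          ≡⟨ solve (b ∷ []) ⟩
    3 * (3 * b)    ≤⟨ *-monoʳ-≤ 3 3b≤c ⟩
    3 * c          ≤⟨ 3c≤a ⟩
    a              ∎
  1≤a : 1 ≤ a
  1≤a = ≤-trans 1≤b (≤-trans (m≤n*m b 9) 9b≤a)
  gap : (b * c + b * c) + (a * (b + c) + a * (b + c)) < a * a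
  gap = *-cancelˡ-< 27 _ _ (begin-strict
    27 * ((b * c + b * c) + (a * (b + c) + a * (b + c)))      ≡⟨ solve (a ∷ b ∷ c ∷ []) ⟩
    2 * ((9 * b) * (3 * c)) + 6 * (a * (9 * b)) + 18 * (a * (3 * c))
      ≤⟨ +-mono-≤ (+-mono-≤ (*-monoʳ-≤ 2 (*-mono-≤ 9b≤a 3c≤a)) (*-monoʳ-≤ 6 (*-monoʳ-≤ a 9b≤a)))
                  (*-monoʳ-≤ 18 (*-monoʳ-≤ a 3c≤a)) ⟩
    2 * (a * a) + 6 * (a * a) + 18 * (a * a)                  <⟨ m<m+n _ (1≤sq 1≤a) ⟩
    2 * (a * a) + 6 * (a * a) + 18 * (a * a) + a * a          ≡⟨ solve (a ∷ []) ⟩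
    27 * (a * a)                                              ∎)

Label : Set
Label = ℕ × Bool

index≢ : ∀ {i j : ℕ} {s : Bool} → (i , s) ≢ (j , s) → i ≢ j
index≢ x≢y refl = x≢y refl

-- (i , false) and (i , true) stand for A_i and B_i. Star K x y: the edge xy has colour K and x is the
-- centre of its star in that colour.
data Star : ℕ → Label → Label → Set where
  matched : ∀ i → Star 0 (i , false) (i , true)
  above   : ∀ {p j} s → p < j → Star (suc p) (p , s) (j , s)
  below   : ∀ {p k} s → k < p → Star (suc p) (p , not s) (k , s)

Linked : ℕ → Label → Label → Set
Linked K x y = Star K x y ⊎ Star K y x

colour : Label → Label → ℕ
colour (i , s) (j , t) with <-cmp i j
... | tri< _ _ _ = suc (if s xor t then j else i)
... | tri≈ _ _ _ = 0
... | tri> _ _ _ = suc (if s xor t then i else j)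

colour-sym : ∀ x y → colour x y ≡ colour y x
colour-sym (i , s) (j , t) with <-cmp i j | <-cmp j i
... | tri< _ _ _   | tri> _ _ _   = cong (λ b → suc (if b then j else i)) (xor-comm s t)
... | tri≈ _ _ _   | tri≈ _ _ _   = refl
... | tri> _ _ _   | tri< _ _ _   = cong (λ b → suc (if b then i else j)) (xor-comm s t)
... | tri< i<j _ _ | tri< j<i _ _ = ⊥-elim (<-asym i<j j<i)
... | tri< i<j _ _ | tri≈ _ j≡i _ = ⊥-elim (<-irrefl (sym j≡i) i<j)
... | tri≈ _ i≡j _ | tri< j<i _ _ = ⊥-elim (<-irrefl (sym i≡j) j<i)
... | tri≈ _ i≡j _ | tri> _ _ i<j = ⊥-elim (<-irrefl i≡j i<j)
... | tri> _ _ j<i | tri≈ _ j≡i _ = ⊥-elim (<-irrefl j≡i j<i)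
... | tri> _ _ j<i | tri> _ _ i<j = ⊥-elim (<-asym i<j j<i)

colour-bounded : ∀ {m} x y → proj₁ x < m → proj₁ y < m → colour x y < suc m
colour-bounded (i , s) (j , t) i<m j<m with <-cmp i j
... | tri≈ _ _ _ = s≤s z≤n
... | tri< _ _ _ with s xor t
...   | true  = s≤s j<m
...   | false = s≤s i<m
colour-bounded (i , s) (j , t) i<m j<m | tri> _ _ _ with s xor t
...   | true  = s≤s i<m
...   | false = s≤s j<m

star-colour : ∀ {K x y} → Star K x y → colour x y ≡ K
star-colour (matched i) with <-cmp i i
... | tri< i<i _ _ = ⊥-elim (<-irrefl refl i<i)
... | tri≈ _ _ _   = refl
... | tri> _ _ i<i = ⊥-elim (<-irrefl refl i<i)
star-colour (above {p} {j} s p<j) with <-cmp p j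
... | tri< _ _ _   = cong (λ b → suc (if b then j else p)) (xor-same s)
... | tri≈ _ p≡j _ = ⊥-elim (<-irrefl p≡j p<j)
... | tri> _ _ j<p = ⊥-elim (<-asym p<j j<p)
star-colour (below {p} {k} s k<p) with <-cmp p k
... | tri< p<k _ _ = ⊥-elim (<-asym p<k k<p)
... | tri≈ _ p≡k _ = ⊥-elim (<-irrefl (sym p≡k) k<p)
... | tri> _ _ _   = cong (λ b → suc (if b then p else k)) (xor-inverseˡ s)

linked-colour : ∀ {K x y} → Linked K x y → colour x y ≡ K
linked-colour (inj₁ xy) = star-colour xy
linked-colour {x = x} {y} (inj₂ yx) = trans (colour-sym x y) (star-colour yx)

star-distinct : ∀ {K x y} → Star K x y → x ≢ y
star-distinct (matched i) ()
star-distinct (above s p<j) e = <-irrefl (cong proj₁ e) p<j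
star-distinct (below s k<p) e = <-irrefl (sym (cong proj₁ e)) k<p

linked-distinct : ∀ {K x y} → Linked K x y → x ≢ y
linked-distinct (inj₁ xy) = star-distinct xy
linked-distinct (inj₂ yx) = star-distinct yx ∘ sym

colour-linked : ∀ x y → x ≢ y → Linked (colour x y) x y
colour-linked (i , s) (j , t) x≢y with <-cmp i j
colour-linked (i , false) (j , false) _ | tri< i<j _ _ = inj₁ (above false i<j)
colour-linked (i , false) (j , true)  _ | tri< i<j _ _ = inj₂ (below false i<j)
colour-linked (i , true)  (j , false) _ | tri< i<j _ _ = inj₂ (below true i<j)
colour-linked (i , true)  (j , true)  _ | tri< i<j _ _ = inj₁ (above true i<j)
colour-linked (i , false) (.i , false) x≢y | tri≈ _ refl _ = ⊥-elim (x≢y refl)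
colour-linked (i , false) (.i , true)  _   | tri≈ _ refl _ = inj₁ (matched i)
colour-linked (i , true)  (.i , false) _   | tri≈ _ refl _ = inj₂ (matched i)
colour-linked (i , true)  (.i , true)  x≢y | tri≈ _ refl _ = ⊥-elim (x≢y refl)
colour-linked (i , false) (j , false) _ | tri> _ _ j<i = inj₂ (above false j<i)
colour-linked (i , false) (j , true)  _ | tri> _ _ j<i = inj₁ (below true j<i)
colour-linked (i , true)  (j , false) _ | tri> _ _ j<i = inj₁ (below false j<i)
colour-linked (i , true)  (j , true)  _ | tri> _ _ j<i = inj₂ (above true j<i)

centre : ℕ → Label → Label
centre zero    (i , _) = (i , false)
centre (suc p) (i , s) with <-cmp i p
... | tri< _ _ _ = (p , not s)
... | tri≈ _ _ _ = (i , s)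
... | tri> _ _ _ = (p , s)

centre-self : ∀ p s → centre (suc p) (p , s) ≡ (p , s)
centre-self p s with <-cmp p p
... | tri< p<p _ _ = ⊥-elim (<-irrefl refl p<p)
... | tri≈ _ _ _   = refl
... | tri> _ _ p<p = ⊥-elim (<-irrefl refl p<p)

centre-idem : ∀ K x → centre K (centre K x) ≡ centre K x
centre-idem zero    (i , s) = refl
centre-idem (suc p) (i , s) with <-cmp i p
... | tri< _ _ _    = centre-self p (not s)
... | tri≈ _ refl _ = centre-self p s
... | tri> _ _ _    = centre-self p s

centre-fixed : ∀ p x → centre (suc p) x ≡ x → proj₁ x ≡ p
centre-fixed p (i , s) cx with <-cmp i p
... | tri< _ _ _   = sym (cong proj₁ cx)
... | tri≈ _ i≡p _ = i≡p
... | tri> _ _ _   = sym (cong proj₁ cx)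

centre-bounded : ∀ {m} K x → K ≤ m → proj₁ x < m → proj₁ (centre K x) < m
centre-bounded zero    (i , s) _   i<m = i<m
centre-bounded (suc p) (i , s) p<m i<m with <-cmp i p
... | tri< _ _ _ = p<m
... | tri≈ _ _ _ = i<m
... | tri> _ _ _ = p<m

star-centre : ∀ {K x y} → Star K x y → centre K x ≡ x × centre K y ≡ x
star-centre (matched i) = refl , refl
star-centre (above {p} {j} s p<j) = centre-self p s , leaf
  where
  leaf : centre (suc p) (j , s) ≡ (p , s)
  leaf with <-cmp j p
  ... | tri< j<p _ _ = ⊥-elim (<-asym p<j j<p)
  ... | tri≈ _ j≡p _ = ⊥-elim (<-irrefl (sym j≡p) p<j)
  ... | tri> _ _ _   = refl
star-centre (below {p} {k} s k<p) = centre-self p (not s) , leaf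
  where
  leaf : centre (suc p) (k , s) ≡ (p , not s)
  leaf with <-cmp k p
  ... | tri< _ _ _   = refl
  ... | tri≈ _ k≡p _ = ⊥-elim (<-irrefl k≡p k<p)
  ... | tri> _ _ p<k = ⊥-elim (<-asym k<p p<k)

centre-star : ∀ K {x y} → x ≢ y → centre K x ≡ x → centre K y ≡ x → Star K x y
centre-star zero {i , false} {.i , false} x≢y refl refl = ⊥-elim (x≢y refl)
centre-star zero {i , false} {.i , true}  _   refl refl = matched i
centre-star (suc p) {i , s} {j , t} x≢y cx cy with centre-fixed p (i , s) cx
... | refl with <-cmp j p
...   | tri< j<p _ _ = subst (λ z → Star (suc p) (p , z) (j , t)) (cong proj₂ cy) (below t j<p)
...   | tri≈ _ _ _   = ⊥-elim (x≢y (sym cy))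
...   | tri> _ _ p<j = subst (λ z → Star (suc p) (p , z) (j , t)) (cong proj₂ cy) (above t p<j)

Spoke : {A : Set} → (A → A) → A → A → Set
Spoke f u v = u ≢ v × ((f u ≡ u × f v ≡ u) ⊎ (f v ≡ v × f u ≡ v))

StarCentre : {A : Set} → (A → A → Set) → (A → A) → Set
StarCentre E f = (∀ v → f (f v) ≡ f v) × (∀ u v → (E u v → Spoke f u v) × (Spoke f u v → E u v))

linked-starCentre : ∀ K → StarCentre (Linked K) (centre K)
linked-starCentre K = centre-idem K , λ x y → spoke , unspoke
  where
  spoke : ∀ {x y} → Linked K x y → Spoke (centre K) x y
  spoke (inj₁ xy) = star-distinct xy , inj₁ (star-centre xy)
  spoke (inj₂ yx) = star-distinct yx ∘ sym , inj₂ (star-centre yx)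
  unspoke : ∀ {x y} → Spoke (centre K) x y → Linked K x y
  unspoke (x≢y , inj₁ (cx , cy)) = inj₁ (centre-star K x≢y cx cy)
  unspoke (x≢y , inj₂ (cy , cx)) = inj₂ (centre-star K (x≢y ∘ sym) cy cx)

starCentre-empty : ∀ {A : Set} {E : A → A → Set} → (∀ u v → ¬ E u v) → StarCentre E id
starCentre-empty {E = E} empty = (λ _ → refl) , λ u v → (⊥-elim ∘ empty u v) , leafless
  where
  leafless : ∀ {u v} → Spoke id u v → E u v
  leafless (u≢v , inj₁ (_ , v≡u)) = ⊥-elim (u≢v (sym v≡u))
  leafless (u≢v , inj₂ (_ , u≡v)) = ⊥-elim (u≢v u≡v)

starCentre-pullback : ∀ {A B : Set} {E : B → B → Set} {F : A → A → Set} {f : B → B} {g : A → A}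
  (ℓ : B → A) → Injective _≡_ _≡_ ℓ → (∀ v → ℓ (f v) ≡ g (ℓ v)) →
  (∀ u v → E u v ⇔ F (ℓ u) (ℓ v)) → StarCentre F g → StarCentre E f
starCentre-pullback {f = f} {g} ℓ ℓ-inj ℓ∘f≡g∘ℓ E⇔F (g-idem , F⇔spoke) =
  f-idem , λ u v → spoke⁺ ∘ proj₁ (F⇔spoke (ℓ u) (ℓ v)) ∘ Equivalence.to (E⇔F u v)
         , Equivalence.from (E⇔F u v) ∘ proj₂ (F⇔spoke (ℓ u) (ℓ v)) ∘ spoke⁻
  where
  f-idem : ∀ v → f (f v) ≡ f v
  f-idem v = ℓ-inj (begin
    ℓ (f (f v))   ≡⟨ ℓ∘f≡g∘ℓ (f v) ⟩
    g (ℓ (f v))   ≡⟨ cong g (ℓ∘f≡g∘ℓ v) ⟩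
    g (g (ℓ v))   ≡⟨ g-idem (ℓ v) ⟩
    g (ℓ v)       ≡⟨ ℓ∘f≡g∘ℓ v ⟨
    ℓ (f v)       ∎)
    where open ≡-Reasoning
  lift : ∀ {u w} → g (ℓ u) ≡ ℓ w → f u ≡ w
  lift {u} e = ℓ-inj (trans (ℓ∘f≡g∘ℓ u) e)
  push : ∀ {u w} → f u ≡ w → g (ℓ u) ≡ ℓ w
  push {u} e = trans (sym (ℓ∘f≡g∘ℓ u)) (cong ℓ e)
  spoke⁺ : ∀ {u v} → Spoke g (ℓ u) (ℓ v) → Spoke f u v
  spoke⁺ (ℓu≢ℓv , spokes) = ℓu≢ℓv ∘ cong ℓ , Sum.map (Product.map lift lift) (Product.map lift lift) spokes
  spoke⁻ : ∀ {u v} → Spoke f u v → Spoke g (ℓ u) (ℓ v)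
  spoke⁻ (u≢v , spokes) = u≢v ∘ ℓ-inj , Sum.map (Product.map push push) (Product.map push push) spokes

sideLabel : ∀ {m} → Fin m ⊎ Fin m → Label
sideLabel (inj₁ i) = (toℕ i , false)
sideLabel (inj₂ i) = (toℕ i , true)

sideLabel-injective : ∀ {m} → Injective _≡_ _≡_ (sideLabel {m})
sideLabel-injective {x = inj₁ i} {inj₁ j} e = cong inj₁ (toℕ-injective (cong proj₁ e))
sideLabel-injective {x = inj₂ i} {inj₂ j} e = cong inj₂ (toℕ-injective (cong proj₁ e))

sideLabel-bounded : ∀ {m} (x : Fin m ⊎ Fin m) → proj₁ (sideLabel x) < m
sideLabel-bounded (inj₁ i) = toℕ<n i
sideLabel-bounded (inj₂ i) = toℕ<n i

labelSide : ∀ {m} (x : Label) → proj₁ x < m → Fin m ⊎ Fin m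
labelSide (i , false) i<m = inj₁ (fromℕ< i<m)
labelSide (i , true)  i<m = inj₂ (fromℕ< i<m)

sideLabel-labelSide : ∀ {m} x (x<m : proj₁ x < m) → sideLabel (labelSide x x<m) ≡ x
sideLabel-labelSide (i , false) i<m = cong (_, false) (toℕ-fromℕ< i<m)
sideLabel-labelSide (i , true)  i<m = cong (_, true) (toℕ-fromℕ< i<m)

label : ∀ m → Fin (m + m) → Label
label m = sideLabel ∘ splitAt m

label-injective : ∀ m → Injective _≡_ _≡_ (label m)
label-injective m {u} {v} e = begin
  u                         ≡⟨ join-splitAt m m u ⟨
  join m m (splitAt m u)    ≡⟨ cong (join m m) (sideLabel-injective e) ⟩
  join m m (splitAt m v)    ≡⟨ join-splitAt m m v ⟩
  v                         ∎
  where open ≡-Reasoning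

label-bounded : ∀ m v → proj₁ (label m v) < m
label-bounded m v = sideLabel-bounded (splitAt m v)

vertex : ∀ m (x : Label) → proj₁ x < m → Fin (m + m)
vertex m x x<m = join m m (labelSide x x<m)

label-vertex : ∀ m x (x<m : proj₁ x < m) → label m (vertex m x x<m) ≡ x
label-vertex m x x<m = trans (cong sideLabel (splitAt-join m m (labelSide x x<m))) (sideLabel-labelSide x x<m)

PlaneStarForestPartition : ℕ → ℕ → Set
PlaneStarForestPartition n C =
  Σ (Fin n → Point) λ P → GeneralPosition P ×
    Σ (Fin n → Fin n → Fin C) λ c →
      (∀ i j → c i j ≡ c j i) ×
      (∀ k → Plane P (ColourClass c k) × StarForest (ColourClass c k))

partition-mono : ∀ {n C C′} → C ≤ C′ → PlaneStarForestPartition n C → PlaneStarForestPartition n C′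
partition-mono {n} {C} {C′} C≤C′ (P , P-gp , c , c-sym , classes) = P , P-gp , c′ , c′-sym , λ k → plane k , starForest k
  where
  c′ : Fin n → Fin n → Fin C′
  c′ u v = inject≤ (c u v) C≤C′
  c′-sym : ∀ u v → c′ u v ≡ c′ v u
  c′-sym u v = cong (λ k → inject≤ k C≤C′) (c-sym u v)
  toℕ-c′ : ∀ u v → toℕ (c′ u v) ≡ toℕ (c u v)
  toℕ-c′ u v = toℕ-inject≤ (c u v) C≤C′
  plane : ∀ k → Plane P (ColourClass c′ k)
  plane k a b d e (a≢b , ab) (d≢e , de) =
    proj₁ (classes (c a b)) a b d e (a≢b , refl) (d≢e , inject≤-injective C≤C′ C≤C′ _ _ (trans de (sym ab)))
  starForest : ∀ k → StarForest (ColourClass c′ k)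
  starForest k with toℕ k <? C
  ... | yes k<C = Product.map₂ (starCentre-pullback id id (λ _ → refl) same-class) (proj₂ (classes (fromℕ< k<C)))
    where
    same-class : ∀ u v → ColourClass c′ k u v ⇔ ColourClass c (fromℕ< k<C) u v
    same-class u v = mk⇔ (Product.map₂ to) (Product.map₂ from)
      where
      to : c′ u v ≡ k → c u v ≡ fromℕ< k<C
      to e = toℕ-injective (trans (sym (toℕ-c′ u v)) (trans (cong toℕ e) (sym (toℕ-fromℕ< k<C))))
      from : c u v ≡ fromℕ< k<C → c′ u v ≡ k
      from e = toℕ-injective (trans (toℕ-c′ u v) (trans (cong toℕ e) (toℕ-fromℕ< k<C)))
  ... | no k≮C = id , starCentre-empty empty
    where
    empty : ∀ u v → ¬ ColourClass c′ k u v
    empty u v (_ , e) = k≮C (subst (_< C) (trans (sym (toℕ-c′ u v)) (cong toℕ e)) (toℕ<n (c u v)))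

module Separated (t : ℕ → ℕ) (t-pos : ∀ i → 1 ≤ t i) (t-sep : ∀ {i j} → i < j → 3 * t i ≤ t j) where

  t-< : ∀ {i j} → i < j → t i < t j
  t-< {i} i<j = <-≤-trans (m<m+n (t i) (≤-trans (t-pos i) (m≤m+n (t i) _))) (t-sep i<j)

  t-≤ : ∀ {i j} → i ≤ j → t i ≤ t j
  t-≤ i≤j with m≤n⇒m<n∨m≡n i≤j
  ... | inj₁ i<j  = <⇒≤ (t-< i<j)
  ... | inj₂ refl = ≤-refl

  t-injective : ∀ {i j} → t i ≡ t j → i ≡ j
  t-injective {i} {j} e with <-cmp i j
  ... | tri< i<j _ _ = ⊥-elim (<-irrefl e (t-< i<j))
  ... | tri≈ _ i≡j _ = i≡j
  ... | tri> _ _ j<i = ⊥-elim (<-irrefl (sym e) (t-< j<i))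

  τ : ℕ → ℤ
  τ i = + t i

  A : ℕ → Point
  A i = α (τ i)

  B : ℕ → Point
  B i = β (τ i)

  point : Label → Point
  point (i , false) = A i
  point (i , true)  = B i

  τ-diff-pos : ∀ {i j} → i < j → 0ℤ ℤ.< τ j ℤ.- τ i
  τ-diff-pos i<j = diff-pos (t-< i<j)

  τ-diff-neg : ∀ {i j} → i < j → τ i ℤ.- τ j ℤ.< 0ℤ
  τ-diff-neg i<j = diff-neg (t-< i<j)

  τ-diff-signed : ∀ {i j} → i ≢ j → Signed (τ j ℤ.- τ i)
  τ-diff-signed {i} {j} i≢j with <-cmp i j
  ... | tri< i<j _ _ = inj₁ (τ-diff-pos i<j)
  ... | tri≈ _ i≡j _ = ⊥-elim (i≢j i≡j)
  ... | tri> _ _ j<i = inj₂ (τ-diff-neg j<i)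

  G-pos : ∀ a {b c} → c < b → 0ℤ ℤ.< G (τ a) (τ b) (τ c)
  G-pos a {c = c} c<b = G-pos-ℕ _ _ _ (t-sep c<b) (t-pos c)

  G-neg : ∀ {a b c} → a < b → b ≤ c → G (τ a) (τ b) (τ c) ℤ.< 0ℤ
  G-neg {a} a<b b≤c = G-neg-ℕ _ _ _ (t-sep a<b) (t-≤ b≤c) (t-pos a)

  H-pos : ∀ {a b} c → a ≤ b → 0ℤ ℤ.< H (τ a) (τ b) (τ c)
  H-pos {a} c a≤b = H-pos-ℕ _ _ _ (t-≤ a≤b) (t-pos a)

  H-neg : ∀ {a b c} → b < c → c < a → H (τ a) (τ b) (τ c) ℤ.< 0ℤ
  H-neg {b = b} b<c c<a = H-neg-ℕ _ _ _ (t-sep b<c) (t-sep c<a) (t-pos b)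

  G-signed : ∀ {a b} c → a ≢ b → Signed (G (τ a) (τ b) (τ c))
  G-signed {a} {b} c a≢b with <-cmp a b
  ... | tri≈ _ a≡b _ = ⊥-elim (a≢b a≡b)
  ... | tri< a<b _ _ with <-cmp c b
  ...   | tri< c<b _ _ = inj₁ (G-pos a c<b)
  ...   | tri≈ _ c≡b _ = inj₂ (G-neg a<b (≤-reflexive (sym c≡b)))
  ...   | tri> _ _ b<c = inj₂ (G-neg a<b (<⇒≤ b<c))
  G-signed {a} {b} c a≢b | tri> _ _ b<a with <-cmp c a
  ...   | tri< c<a _ _ = inj₁ (subst (0ℤ ℤ.<_) (G-comm (τ b) (τ a) (τ c)) (G-pos b c<a))
  ...   | tri≈ _ c≡a _ = inj₂ (subst (ℤ._< 0ℤ) (G-comm (τ b) (τ a) (τ c)) (G-neg b<a (≤-reflexive (sym c≡a))))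
  ...   | tri> _ _ a<c = inj₂ (subst (ℤ._< 0ℤ) (G-comm (τ b) (τ a) (τ c)) (G-neg b<a (<⇒≤ a<c)))

  H-signed : ∀ a {b c} → b ≢ c → Signed (H (τ a) (τ b) (τ c))
  H-signed a {b} {c} b≢c with ≤-<-connex a b
  ... | inj₁ a≤b = inj₁ (H-pos c a≤b)
  ... | inj₂ b<a with ≤-<-connex a c
  ...   | inj₁ a≤c = inj₁ (subst (0ℤ ℤ.<_) (H-comm (τ a) (τ c) (τ b)) (H-pos b a≤c))
  ...   | inj₂ c<a with <-cmp b c
  ...     | tri< b<c _ _ = inj₂ (H-neg b<c c<a)
  ...     | tri≈ _ b≡c _ = ⊥-elim (b≢c b≡c)
  ...     | tri> _ _ c<b = inj₂ (subst (ℤ._< 0ℤ) (H-comm (τ a) (τ c) (τ b)) (H-neg c<b b<a))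

  AAA-pos : ∀ {a b c} → a < b → b < c → 0ℤ ℤ.< orient (A a) (A b) (A c)
  AAA-pos {a} {b} {c} a<b b<c = subst (0ℤ ℤ.<_) (sym (orient-ααα (τ a) (τ b) (τ c)))
    (pos*pos (τ-diff-pos a<b) (pos*pos (τ-diff-pos (<-trans a<b b<c)) (τ-diff-pos b<c)))

  BBB-pos : ∀ {a b c} → a < b → b < c → 0ℤ ℤ.< orient (B a) (B b) (B c)
  BBB-pos {a} {b} {c} a<b b<c = subst (0ℤ ℤ.<_) (sym (orient-βββ (τ a) (τ b) (τ c)))
    (pos*pos (neg*neg (τ-diff-neg a<b) (neg*pos (τ-diff-neg (<-trans a<b b<c)) (τ-diff-pos b<c))) (+<+ (s≤s z≤n)))

  AAB-pos : ∀ {a b c} → a < b → c < b → 0ℤ ℤ.< orient (A a) (A b) (B c)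
  AAB-pos {a} {b} {c} a<b c<b = subst (0ℤ ℤ.<_) (sym (orient-ααβ (τ a) (τ b) (τ c))) (pos*pos (τ-diff-pos a<b) (G-pos a c<b))

  AAB-neg : ∀ {a b c} → a < b → b ≤ c → orient (A a) (A b) (B c) ℤ.< 0ℤ
  AAB-neg {a} {b} {c} a<b b≤c = subst (ℤ._< 0ℤ) (sym (orient-ααβ (τ a) (τ b) (τ c))) (pos*neg (τ-diff-pos a<b) (G-neg a<b b≤c))

  ABB-pos : ∀ {a b c} → b < c → a ≤ c → 0ℤ ℤ.< orient (A a) (B b) (B c)
  ABB-pos {a} {b} {c} b<c a≤c = subst (0ℤ ℤ.<_) (sym (orient-αββ (τ a) (τ b) (τ c)))
    (pos*pos (τ-diff-pos b<c) (subst (0ℤ ℤ.<_) (H-comm (τ a) (τ c) (τ b)) (H-pos b a≤c)))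

  AAA-≢0 : ∀ {a b c} → a ≢ b → a ≢ c → b ≢ c → orient (A a) (A b) (A c) ≢ 0ℤ
  AAA-≢0 {a} {b} {c} a≢b a≢c b≢c = signed⇒≢0 (subst Signed (sym (orient-ααα (τ a) (τ b) (τ c)))
    (signed-* (τ-diff-signed a≢b) (signed-* (τ-diff-signed a≢c) (τ-diff-signed b≢c))))

  BBB-≢0 : ∀ {a b c} → a ≢ b → a ≢ c → b ≢ c → orient (B a) (B b) (B c) ≢ 0ℤ
  BBB-≢0 {a} {b} {c} a≢b a≢c b≢c = signed⇒≢0 (subst Signed (sym (orient-βββ (τ a) (τ b) (τ c)))
    (signed-* (signed-* (τ-diff-signed (≢-sym a≢b)) (signed-* (τ-diff-signed (≢-sym a≢c)) (τ-diff-signed b≢c)))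
              (inj₁ (+<+ (s≤s z≤n)))))

  AAB-≢0 : ∀ {a b} c → a ≢ b → orient (A a) (A b) (B c) ≢ 0ℤ
  AAB-≢0 {a} {b} c a≢b = signed⇒≢0 (subst Signed (sym (orient-ααβ (τ a) (τ b) (τ c)))
    (signed-* (τ-diff-signed a≢b) (G-signed c a≢b)))

  ABB-≢0 : ∀ a {b c} → b ≢ c → orient (A a) (B b) (B c) ≢ 0ℤ
  ABB-≢0 a {b} {c} b≢c = signed⇒≢0 (subst Signed (sym (orient-αββ (τ a) (τ b) (τ c)))
    (signed-* (τ-diff-signed b≢c) (H-signed a b≢c)))

  ≢0-rotate : ∀ p q r → orient p q r ≢ 0ℤ → orient q r p ≢ 0ℤ
  ≢0-rotate p q r pqr≢0 = pqr≢0 ∘ trans (orient-rotate p q r)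

  point-generalPosition : ∀ x y z → x ≢ y → y ≢ z → x ≢ z → orient (point x) (point y) (point z) ≢ 0ℤ
  point-generalPosition (i , false) (j , false) (k , false) x≢y y≢z x≢z = AAA-≢0 (index≢ x≢y) (index≢ x≢z) (index≢ y≢z)
  point-generalPosition (i , false) (j , false) (k , true)  x≢y _   _   = AAB-≢0 k (index≢ x≢y)
  point-generalPosition (i , false) (j , true)  (k , false) _   _   x≢z =
    ≢0-rotate (A k) (A i) (B j) (AAB-≢0 j (index≢ (≢-sym x≢z)))
  point-generalPosition (i , true)  (j , false) (k , false) _   y≢z _   =
    ≢0-rotate (A k) (B i) (A j) (≢0-rotate (A j) (A k) (B i) (AAB-≢0 i (index≢ y≢z)))
  point-generalPosition (i , false) (j , true)  (k , true)  _   y≢z _   = ABB-≢0 i (index≢ y≢z)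
  point-generalPosition (i , true)  (j , false) (k , true)  _   _   x≢z =
    ≢0-rotate (B k) (B i) (A j) (≢0-rotate (A j) (B k) (B i) (ABB-≢0 j (index≢ (≢-sym x≢z))))
  point-generalPosition (i , true)  (j , true)  (k , false) x≢y _   _   = ≢0-rotate (A k) (B i) (B j) (ABB-≢0 k (index≢ x≢y))
  point-generalPosition (i , true)  (j , true)  (k , true)  x≢y y≢z x≢z = BBB-≢0 (index≢ x≢y) (index≢ x≢z) (index≢ y≢z)

  point-injective : Injective _≡_ _≡_ point
  point-injective {i , false} {j , false} e = cong (_, false) (t-injective (ℤP.+-injective (cong proj₁ e)))
  point-injective {i , true}  {j , true}  e = cong (_, true) (t-injective (ℤP.+-injective (ℤP.neg-injective (cong proj₁ e))))
  point-injective {i , false} {j , true}  e = ⊥-elim (+≢-+ (t-pos j) (cong proj₁ e))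
  point-injective {i , true}  {j , false} e = ⊥-elim (+≢-+ (t-pos i) (sym (cong proj₁ e)))

  noncross-AA-BB : ∀ {p j j′} → p < j → p < j′ → ¬ Cross (A p) (A j) (B p) (B j′)
  noncross-AA-BB {p} {j} {j′} p<j p<j′ with ≤-<-connex j j′
  ... | inj₁ j≤j′ = sameSide⇒¬cross′ (left (pos-rotate (A p) (B p) (B j′) (ABB-pos p<j′ (<⇒≤ p<j′)))
                                          (pos-rotate (A j) (B p) (B j′) (ABB-pos p<j′ j≤j′)))
  ... | inj₂ j′<j = sameSide⇒¬cross (left (AAB-pos p<j p<j) (AAB-pos p<j j′<j))

  noncross-AA-BA : ∀ {p j k} → p < j → k < p → ¬ Cross (A p) (A j) (B p) (A k)
  noncross-AA-BA {p} {j} {k} p<j k<p =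
    sameSide⇒¬cross (left (AAB-pos p<j p<j) (pos-rotate (A k) (A p) (A j) (AAA-pos k<p p<j)))

  noncross-AB-BB : ∀ {p j k} → k < p → p < j → ¬ Cross (A p) (B k) (B p) (B j)
  noncross-AB-BB {p} {j} {k} k<p p<j =
    sameSide⇒¬cross′ (left (pos-rotate (A p) (B p) (B j) (ABB-pos p<j (<⇒≤ p<j)))
                           (pos-rotate (B k) (B p) (B j) (BBB-pos k<p p<j)))

  noncross-AB-BA : ∀ {p k k′} → k < p → k′ < p → ¬ Cross (A p) (B k) (B p) (A k′)
  noncross-AB-BA {p} {k} {k′} k<p k′<p =
    sameSide⇒¬cross (left (ABB-pos k<p ≤-refl) (pos-rotate (A k′) (A p) (B k) (AAB-pos k′<p k<p)))

  noncross-matching : ∀ {i j} → i < j → ¬ Cross (A i) (B i) (A j) (B j)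
  noncross-matching {i} {j} i<j = sameSide⇒¬cross′ (right (neg-rotate (A i) (A j) (B j) (AAB-neg i<j ≤-refl)) Bi-right-of-AjBj)
    where
    Bi-right-of-AjBj : orient (A j) (B j) (B i) ℤ.< 0ℤ
    Bi-right-of-AjBj = subst (ℤ._< 0ℤ)
      (sym (trans (orient-swap (A j) (B j) (B i)) (cong ℤ.-_ (orient-rotate (B j) (A j) (B i)))))
      (ℤP.neg-mono-< (ABB-pos i<j ≤-refl))

  star-noncrossing : ∀ {K a b c d} → Star K a b → Star K c d → ¬ Cross (point a) (point b) (point c) (point d)
  star-noncrossing (matched i) (matched j) with <-cmp i j
  ... | tri< i<j _ _  = noncross-matching i<j
  ... | tri≈ _ refl _ = ¬cross-shared
  ... | tri> _ _ j<i  = noncross-matching j<i ∘ cross-sym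
  star-noncrossing (above false _)   (above false _)   = ¬cross-shared
  star-noncrossing (above false p<j) (above true p<j′) = noncross-AA-BB p<j p<j′
  star-noncrossing (above false p<j) (below false k<p) = noncross-AA-BA p<j k<p
  star-noncrossing (above false _)   (below true _)    = ¬cross-shared
  star-noncrossing (above true p<j)  (above false p<j′) = noncross-AA-BB p<j′ p<j ∘ cross-sym
  star-noncrossing (above true _)    (above true _)    = ¬cross-shared
  star-noncrossing (above true _)    (below false _)   = ¬cross-shared
  star-noncrossing (above true p<j)  (below true k<p)  = noncross-AB-BB k<p p<j ∘ cross-sym
  star-noncrossing (below false k<p) (above false p<j) = noncross-AA-BA p<j k<p ∘ cross-sym
  star-noncrossing (below false _)   (above true _)    = ¬cross-shared
  star-noncrossing (below false _)   (below false _)   = ¬cross-shared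
  star-noncrossing (below false k<p) (below true k′<p) = noncross-AB-BA k′<p k<p ∘ cross-sym
  star-noncrossing (below true _)    (above false _)   = ¬cross-shared
  star-noncrossing (below true k<p)  (above true p<j)  = noncross-AB-BB k<p p<j
  star-noncrossing (below true k<p)  (below false k′<p) = noncross-AB-BA k<p k′<p
  star-noncrossing (below true _)    (below true _)    = ¬cross-shared

  linked-noncrossing : ∀ {K a b c d} → Linked K a b → Linked K c d → ¬ Cross (point a) (point b) (point c) (point d)
  linked-noncrossing (inj₁ ab) (inj₁ cd) = star-noncrossing ab cd
  linked-noncrossing (inj₂ ba) (inj₁ cd) = star-noncrossing ba cd ∘ cross-flipˡ
  linked-noncrossing (inj₁ ab) (inj₂ dc) = star-noncrossing ab dc ∘ cross-flipʳ
  linked-noncrossing (inj₂ ba) (inj₂ dc) = star-noncrossing ba dc ∘ cross-flipʳ ∘ cross-flipˡ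

  partition : ∀ m → PlaneStarForestPartition (m + m) (suc m)
  partition m = P , (P-injective , P-generalPosition) , c , c-sym , λ k → plane k , starForest k
    where
    ℓ : Fin (m + m) → Label
    ℓ = label m
    ℓ-injective : Injective _≡_ _≡_ ℓ
    ℓ-injective = label-injective m
    P : Fin (m + m) → Point
    P = point ∘ ℓ
    P-injective : Injective _≡_ _≡_ P
    P-injective = ℓ-injective ∘ point-injective
    P-generalPosition : ∀ i j k → i ≢ j → j ≢ k → i ≢ k → orient (P i) (P j) (P k) ≢ 0ℤ
    P-generalPosition i j k i≢j j≢k i≢k =
      point-generalPosition (ℓ i) (ℓ j) (ℓ k) (i≢j ∘ ℓ-injective) (j≢k ∘ ℓ-injective) (i≢k ∘ ℓ-injective)
    colour< : ∀ u v → colour (ℓ u) (ℓ v) < suc m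
    colour< u v = colour-bounded (ℓ u) (ℓ v) (label-bounded m u) (label-bounded m v)
    c : Fin (m + m) → Fin (m + m) → Fin (suc m)
    c u v = fromℕ< (colour< u v)
    toℕ-c : ∀ u v → toℕ (c u v) ≡ colour (ℓ u) (ℓ v)
    toℕ-c u v = toℕ-fromℕ< (colour< u v)
    c-sym : ∀ u v → c u v ≡ c v u
    c-sym u v = toℕ-injective (trans (toℕ-c u v) (trans (colour-sym (ℓ u) (ℓ v)) (sym (toℕ-c v u))))
    class⇔linked : ∀ k u v → ColourClass c k u v ⇔ Linked (toℕ k) (ℓ u) (ℓ v)
    class⇔linked k u v = mk⇔ to from
      where
      to : ColourClass c k u v → Linked (toℕ k) (ℓ u) (ℓ v)
      to (u≢v , cuv≡k) = subst (λ K → Linked K (ℓ u) (ℓ v)) (trans (sym (toℕ-c u v)) (cong toℕ cuv≡k))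
                               (colour-linked (ℓ u) (ℓ v) (u≢v ∘ ℓ-injective))
      from : Linked (toℕ k) (ℓ u) (ℓ v) → ColourClass c k u v
      from uv = linked-distinct uv ∘ cong ℓ , toℕ-injective (trans (toℕ-c u v) (linked-colour uv))
    plane : ∀ k → Plane P (ColourClass c k)
    plane k a b d e ab de (h₁ , h₂) = linked-noncrossing (linked ab) (linked de) (cross h₁ h₂)
      where
      linked : ∀ {u v} → ColourClass c k u v → Linked (toℕ k) (ℓ u) (ℓ v)
      linked = Equivalence.to (class⇔linked k _ _)
    starForest : ∀ k → StarForest (ColourClass c k)
    starForest k = f , starCentre-pullback ℓ ℓ-injective ℓ∘f≡centre∘ℓ (class⇔linked k) (linked-starCentre (toℕ k))
      where
      f : Fin (m + m) → Fin (m + m)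
      f v = vertex m (centre (toℕ k) (ℓ v)) (centre-bounded (toℕ k) (ℓ v) (toℕ≤pred[n] k) (label-bounded m v))
      ℓ∘f≡centre∘ℓ : ∀ v → ℓ (f v) ≡ centre (toℕ k) (ℓ v)
      ℓ∘f≡centre∘ℓ v = label-vertex m _ _

open Separated (3 ^_) (m^n>0 3) (^-monoʳ-≤ 3) using (partition)

corollary1 : (n : ℕ) → zero < n → 6 ∣ n →
    Σ (Fin n → Point) λ P → GeneralPosition P ×
    Σ (Fin n → Fin n → Fin ((2 * n) / 3)) λ c →
    (∀ i j → c i j ≡ c j i) ×
    (∀ k → Plane P (ColourClass c k) × StarForest (ColourClass c k))
corollary1 .(zero * 6) () (divides zero refl)
corollary1 .(suc q * 6) _ (divides (suc q) refl) =
  subst (λ n → PlaneStarForestPartition n ((2 * (suc q * 6)) / 3)) half+half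
    (partition-mono enough-colours (partition (suc q * 3)))
  where
  half+half : suc q * 3 + suc q * 3 ≡ suc q * 6
  half+half = solve (q ∷ [])
  enough-colours : suc (suc q * 3) ≤ (2 * (suc q * 6)) / 3
  enough-colours = begin
    suc (suc q * 3)            ≤⟨ *-monoʳ-< (suc q) (n<1+n 3) ⟩
    suc q * 4                  ≡⟨ m*n/n≡m (suc q * 4) 3 ⟨
    suc q * 4 * 3 / 3          ≡⟨ cong (_/ 3) 2n≡4q*3 ⟩
    2 * (suc q * 6) / 3        ∎
    where
    open ≤-Reasoning
    2n≡4q*3 : suc q * 4 * 3 ≡ 2 * (suc q * 6)
    2n≡4q*3 = solve (q ∷ [])
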